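{- Let $n=2^\ell$, $m=2n+1$, and $f:\{0,1\}^{m\ell+n}\to\{0,1\}^n$. If $f$ is blob-like and every slice function $f_T$ ($T\in\{0,1\}^\ell$) is 1-Lipschitz, then $f$ is 1-Lipschitz.
   Context: For $T\in\{0,1\}^\ell$ with bits $T_1,\dots,T_\ell$, the slice function $f_T:\{0,1\}^n\to\{0,1\}^n$ is $f_T(X)=f(T_1^{m}T_2^{m}\cdots T_\ell^{m}X)$, where $b^{m}$ denotes the bit $b$ repeated $m$ times. For an input $R_1\cdots R_\ell X$ with $|R_i|=m$, $|X|=n$, let $z_i$ and $o_i$ be the numbers of zeros and ones in $R_i$; put $t_i=0$ if $z_i>o_i$ and $t_i=1$ if $z_i<o_i$, $T=t_1\cdots t_\ell$, $x_i=\min(z_i,o_i)$ and $x=\max_i x_i$. The function $f$ is blob-like if for all such inputs $f(R_1\cdots R_\ell X)=f_T(X)\wedge(0^{x}1^{n-x})$ (bitwise AND). A function between bit strings is 1-Lipschitz if any two inputs at Hamming distance $1$ have outputs at Hamming distance at most $1$. -}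

module Defs where

open import Data.Bool using (Bool; true; false; _∧_; not; if_then_else_)
open import Data.Nat using (ℕ; zero; suc; _+_; _*_; _^_; _≤_; _<_; _⊔_; _⊓_; _<ᵇ_)
open import Data.Vec using (Vec; []; _∷_; _++_; concat; replicate; zipWith; map; countᵇ; foldr)
open import Data.Bool using (_xor_)
open import Relation.Binary.PropositionalEquality using (_≡_)

BitString : ℕ → Set
BitString k = Vec Bool k

hamming : ∀ {k} → BitString k → BitString k → ℕ
hamming u v = countᵇ (λ b → b) (zipWith _xor_ u v)

OneLipschitz : ∀ {a b} → (BitString a → BitString b) → Set
OneLipschitz {a} g = ∀ (u v : BitString a) → hamming u v ≡ 1 → hamming (g u) (g v) ≤ 1

zeros ones : ∀ {k} → BitString k → ℕ
zeros = countᵇ not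
ones  = countᵇ (λ b → b)

-- majority bit t_i : 1 iff more ones than zeros (ties impossible for odd block length)
majority : ∀ {k} → BitString k → Bool
majority r = zeros r <ᵇ ones r

minority : ∀ {k} → BitString k → ℕ
minority r = zeros r ⊓ ones r

maxMinority : ∀ {ℓ k} → Vec (BitString k) ℓ → ℕ
maxMinority = foldr _ (λ r acc → minority r ⊔ acc) 0

-- 0^x 1^(n-x) as a bit string of length n (position i is 1 iff i ≥ x)
mask : (n x : ℕ) → BitString n
mask zero    x       = []
mask (suc n) zero    = true ∷ mask n zero
mask (suc n) (suc x) = false ∷ mask n x

slice : ∀ {ℓ m n} → (BitString (ℓ * m + n) → BitString n) →
        BitString ℓ → BitString n → BitString n
slice {ℓ} {m} f T X = f (concat (map (replicate m) T) ++ X)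

BlobLike : ∀ {ℓ m n} → (BitString (ℓ * m + n) → BitString n) → Set
BlobLike {ℓ} {m} {n} f =
  ∀ (R : Vec (BitString m) ℓ) (X : BitString n) →
    f (concat R ++ X) ≡
      zipWith _∧_ (slice {ℓ} {m} {n} f (map majority R) X) (mask n (maxMinority R))

-- Cut an input into its ℓ blocks R and its tail X, and let T and x be the majority
-- pattern and maximal minority count of R. If the flipped bit lies in X, then T and x
-- are unchanged and the slice f_T is 1-Lipschitz; masking with a fixed word does not
-- increase the distance. If it lies in a block, X is unchanged, the minority count of
-- that block, hence x, moves by at most one, so the mask 0^x 1^(n-x) changes in at most
-- one position. The majority of a block of odd length 2n+1 changes only when its counts
-- pass between (n+1, n) and (n, n+1); then x ≥ n and both outputs are 0^n.
-- Nothing uses n = 2^ℓ beyond the block length being m = 2n+1.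
module Submission where

open import Defs
open import Data.Bool using (true; false; _∧_)
open import Data.Bool.Properties using (∧-zeroʳ; ∧-comm; T-≡)
open import Data.Nat using (ℕ; zero; suc; _+_; _*_; _^_; _≤_; _<_; _⊔_; _⊓_; _<ᵇ_; ∣_-_∣; z≤n; s≤s)
open import Data.Nat.Properties
open import Data.Product using (_×_; _,_)
import Data.Product as Product
open import Data.Sum using (_⊎_; inj₁; inj₂)
import Data.Sum as Sum
open import Data.Vec using (Vec; []; _∷_; _++_; concat; replicate; zipWith; map; splitAt; group)
open import Data.Vec.Properties using (++-injectiveˡ; ++-injectiveʳ; zipWith-comm; zipWith-zeroʳ)
open import Function using (_∘_)
open import Function.Bundles using (Equivalence)
open import Relation.Binary.Definitions using (tri<; tri≈; tri>)
open import Relation.Binary.PropositionalEquality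

concat-injective : ∀ {A : Set} {ℓ k} (R R' : Vec (Vec A k) ℓ) → concat R ≡ concat R' → R ≡ R'
concat-injective []      []        _ = refl
concat-injective (r ∷ R) (r' ∷ R') e =
  cong₂ _∷_ (++-injectiveˡ r r' e) (concat-injective R R' (++-injectiveʳ r r' e))

hamming-refl : ∀ {k} (x : BitString k) → hamming x x ≡ 0
hamming-refl []          = refl
hamming-refl (true  ∷ x) = hamming-refl x
hamming-refl (false ∷ x) = hamming-refl x

hamming≡0⇒≡ : ∀ {k} (x y : BitString k) → hamming x y ≡ 0 → x ≡ y
hamming≡0⇒≡ []          []          _ = refl
hamming≡0⇒≡ (true  ∷ x) (true  ∷ y) d = cong (true ∷_) (hamming≡0⇒≡ x y d)
hamming≡0⇒≡ (false ∷ x) (false ∷ y) d = cong (false ∷_) (hamming≡0⇒≡ x y d)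

hamming-++ : ∀ {a b} (x x' : BitString a) (y y' : BitString b) →
             hamming (x ++ y) (x' ++ y') ≡ hamming x x' + hamming y y'
hamming-++ []          []           y y' = refl
hamming-++ (true  ∷ x) (true  ∷ x') y y' = hamming-++ x x' y y'
hamming-++ (true  ∷ x) (false ∷ x') y y' = cong suc (hamming-++ x x' y y')
hamming-++ (false ∷ x) (true  ∷ x') y y' = cong suc (hamming-++ x x' y y')
hamming-++ (false ∷ x) (false ∷ x') y y' = hamming-++ x x' y y'

hamming-++≡1 : ∀ {a b} (x x' : BitString a) (y y' : BitString b) →
               hamming (x ++ y) (x' ++ y') ≡ 1 →
               (x ≡ x' × hamming y y' ≡ 1) ⊎ (hamming x x' ≡ 1 × y ≡ y')
hamming-++≡1 x x' y y' d with hamming x x' in e | trans (sym (hamming-++ x x' y y')) d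
... | zero     | d' = inj₁ (hamming≡0⇒≡ x x' e , d')
... | suc zero | d' = inj₂ (refl , hamming≡0⇒≡ y y' (suc-injective d'))

hamming-∧ˡ : ∀ {k} (x y w : BitString k) →
             hamming (zipWith _∧_ x w) (zipWith _∧_ y w) ≤ hamming x y
hamming-∧ˡ []          []          []          = z≤n
hamming-∧ˡ (true  ∷ x) (true  ∷ y) (true  ∷ w) = hamming-∧ˡ x y w
hamming-∧ˡ (true  ∷ x) (true  ∷ y) (false ∷ w) = hamming-∧ˡ x y w
hamming-∧ˡ (false ∷ x) (false ∷ y) (true  ∷ w) = hamming-∧ˡ x y w
hamming-∧ˡ (false ∷ x) (false ∷ y) (false ∷ w) = hamming-∧ˡ x y w
hamming-∧ˡ (true  ∷ x) (false ∷ y) (true  ∷ w) = s≤s (hamming-∧ˡ x y w)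
hamming-∧ˡ (false ∷ x) (true  ∷ y) (true  ∷ w) = s≤s (hamming-∧ˡ x y w)
hamming-∧ˡ (true  ∷ x) (false ∷ y) (false ∷ w) = m≤n⇒m≤1+n (hamming-∧ˡ x y w)
hamming-∧ˡ (false ∷ x) (true  ∷ y) (false ∷ w) = m≤n⇒m≤1+n (hamming-∧ˡ x y w)

hamming-∧ʳ : ∀ {k} (x w w' : BitString k) →
             hamming (zipWith _∧_ x w) (zipWith _∧_ x w') ≤ hamming w w'
hamming-∧ʳ x w w' =
  subst₂ (λ a b → hamming a b ≤ hamming w w')
         (zipWith-comm ∧-comm w x) (zipWith-comm ∧-comm w' x) (hamming-∧ˡ w w' x)

zeros+ones : ∀ {k} (r : BitString k) → zeros r + ones r ≡ k
zeros+ones []          = refl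
zeros+ones (true  ∷ r) = trans (+-suc (zeros r) (ones r)) (cong suc (zeros+ones r))
zeros+ones (false ∷ r) = cong suc (zeros+ones r)

-- Counts (zeros, ones) before and after turning one 0 into a 1.
data RaiseCounts : ℕ → ℕ → ℕ → ℕ → Set where
  raise : ∀ {z o} → RaiseCounts (suc z) o z (suc o)

raise-∷-true : ∀ {z o z' o'} → RaiseCounts z o z' o' → RaiseCounts z (suc o) z' (suc o')
raise-∷-true raise = raise

raise-∷-false : ∀ {z o z' o'} → RaiseCounts z o z' o' → RaiseCounts (suc z) o (suc z') o'
raise-∷-false raise = raise

hamming≡1⇒raise : ∀ {k} (r r' : BitString k) → hamming r r' ≡ 1 →
                  RaiseCounts (zeros r) (ones r) (zeros r') (ones r') ⊎
                  RaiseCounts (zeros r') (ones r') (zeros r) (ones r)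
hamming≡1⇒raise [] [] ()
hamming≡1⇒raise (true ∷ r) (true ∷ r') d =
  Sum.map raise-∷-true raise-∷-true (hamming≡1⇒raise r r' d)
hamming≡1⇒raise (false ∷ r) (false ∷ r') d =
  Sum.map raise-∷-false raise-∷-false (hamming≡1⇒raise r r' d)
hamming≡1⇒raise (false ∷ r) (true ∷ r') d with hamming≡0⇒≡ r r' (suc-injective d)
... | refl = inj₁ raise
hamming≡1⇒raise (true ∷ r) (false ∷ r') d with hamming≡0⇒≡ r r' (suc-injective d)
... | refl = inj₂ raise

∣suc⊓-⊓suc∣≤1 : ∀ z o → ∣ suc z ⊓ o - z ⊓ suc o ∣ ≤ 1
∣suc⊓-⊓suc∣≤1 zero    zero    = z≤n
∣suc⊓-⊓suc∣≤1 zero    (suc o) = ≤-refl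
∣suc⊓-⊓suc∣≤1 (suc z) zero    = ≤-reflexive (cong suc (⊓-zeroʳ z))
∣suc⊓-⊓suc∣≤1 (suc z) (suc o) = ∣suc⊓-⊓suc∣≤1 z o

minority-raise : ∀ {z o z' o'} → RaiseCounts z o z' o' → ∣ z ⊓ o - z' ⊓ o' ∣ ≤ 1
minority-raise (raise {z} {o}) = ∣suc⊓-⊓suc∣≤1 z o

minority-flip : ∀ {k} (r r' : BitString k) → hamming r r' ≡ 1 →
                ∣ minority r - minority r' ∣ ≤ 1
minority-flip r r' d with hamming≡1⇒raise r r' d
... | inj₁ up   = minority-raise up
... | inj₂ down = subst (_≤ 1) (∣-∣-comm (minority r') (minority r)) (minority-raise down)

-- For majority patterns t, t' and maximal minority counts x, x' of neighbouring inputs: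
-- the pattern survives unless both masks are 0^n.
SameOrSaturated : ∀ {A : Set} → ℕ → A → A → ℕ → ℕ → Set
SameOrSaturated n t t' x x' = t ≡ t' ⊎ (n ≤ x × n ≤ x')

m+n≡o+p∧m<o⇒p<n : ∀ {m n o p} → m + n ≡ o + p → m < o → p < n
m+n≡o+p∧m<o⇒p<n e m<o = ≰⇒> (λ n≤p → <-irrefl e (+-mono-<-≤ m<o n≤p))

<⇒<ᵇ≡true : ∀ {m n} → m < n → (m <ᵇ n) ≡ true
<⇒<ᵇ≡true = Equivalence.to T-≡ ∘ <⇒<ᵇ

≤⇒<ᵇ≡false : ∀ {m n} → n ≤ m → (m <ᵇ n) ≡ false
≤⇒<ᵇ≡false {m}     {zero}  _         = refl
≤⇒<ᵇ≡false {suc m} {suc n} (s≤s n≤m) = ≤⇒<ᵇ≡false n≤m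

-- The counts are (z + 1, o) before the raise, with z + o = 2n; comparing z with n shows
-- that the majority flips only at z = o = n.
majority-raise : ∀ n {z o z' o'} → RaiseCounts z o z' o' → z + o ≡ suc (2 * n) →
                 SameOrSaturated n (z <ᵇ o) (z' <ᵇ o') (z ⊓ o) (z' ⊓ o')
majority-raise n (raise {z} {o}) total
  with <-cmp z n | trans (suc-injective total) (cong (n +_) (+-identityʳ n))
... | tri< z<n _ _ | halves = inj₁ (trans (<⇒<ᵇ≡true (≤-<-trans z<n n<o))
                                          (sym (<⇒<ᵇ≡true (m<n⇒m<1+n (<-trans z<n n<o)))))
  where n<o = m+n≡o+p∧m<o⇒p<n halves z<n
... | tri> _ _ n<z | halves = inj₁ (trans (≤⇒<ᵇ≡false (<⇒≤ (<-trans o<n (m<n⇒m<1+n n<z))))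
                                          (sym (≤⇒<ᵇ≡false (<-trans o<n n<z))))
  where o<n = m+n≡o+p∧m<o⇒p<n (sym halves) n<z
... | tri≈ _ refl _ | halves rewrite +-cancelˡ-≡ n o n halves =
  inj₂ (⊓-glb (n≤1+n n) ≤-refl , ⊓-glb ≤-refl (n≤1+n n))

majority-flip : ∀ n (r r' : BitString (suc (2 * n))) → hamming r r' ≡ 1 →
                SameOrSaturated n (majority r) (majority r') (minority r) (minority r')
majority-flip n r r' d with hamming≡1⇒raise r r' d
... | inj₁ up   = majority-raise n up (zeros+ones r)
... | inj₂ down = Sum.map sym Product.swap (majority-raise n down (zeros+ones r'))

∣m⊔o-n⊔o∣≤∣m-n∣ : ∀ m n o → ∣ m ⊔ o - n ⊔ o ∣ ≤ ∣ m - n ∣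
∣m⊔o-n⊔o∣≤∣m-n∣ zero    zero    o       = ≤-reflexive (∣n-n∣≡0 o)
∣m⊔o-n⊔o∣≤∣m-n∣ zero    (suc n) zero    = ≤-refl
∣m⊔o-n⊔o∣≤∣m-n∣ zero    (suc n) (suc o) = m≤n⇒m≤1+n (∣m⊔o-n⊔o∣≤∣m-n∣ zero n o)
∣m⊔o-n⊔o∣≤∣m-n∣ (suc m) zero    zero    = ≤-refl
∣m⊔o-n⊔o∣≤∣m-n∣ (suc m) zero    (suc o) =
  m≤n⇒m≤1+n (≤-trans (∣m⊔o-n⊔o∣≤∣m-n∣ m zero o) (≤-reflexive (∣-∣-identityʳ m)))
∣m⊔o-n⊔o∣≤∣m-n∣ (suc m) (suc n) zero    = ≤-refl
∣m⊔o-n⊔o∣≤∣m-n∣ (suc m) (suc n) (suc o) = ∣m⊔o-n⊔o∣≤∣m-n∣ m n o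

∣o⊔m-o⊔n∣≤∣m-n∣ : ∀ m n o → ∣ o ⊔ m - o ⊔ n ∣ ≤ ∣ m - n ∣
∣o⊔m-o⊔n∣≤∣m-n∣ m n o =
  subst₂ (λ a b → ∣ a - b ∣ ≤ ∣ m - n ∣) (⊔-comm m o) (⊔-comm n o) (∣m⊔o-n⊔o∣≤∣m-n∣ m n o)

maxMinority-flip : ∀ {ℓ k} (R R' : Vec (BitString k) ℓ) →
                   hamming (concat R) (concat R') ≡ 1 →
                   ∣ maxMinority R - maxMinority R' ∣ ≤ 1
maxMinority-flip []      []        ()
maxMinority-flip (r ∷ R) (r' ∷ R') d with hamming-++≡1 r r' (concat R) (concat R') d
... | inj₁ (refl , d') =
  ≤-trans (∣o⊔m-o⊔n∣≤∣m-n∣ (maxMinority R) (maxMinority R') (minority r)) (maxMinority-flip R R' d')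
... | inj₂ (d' , e) rewrite concat-injective R R' e =
  ≤-trans (∣m⊔o-n⊔o∣≤∣m-n∣ (minority r) (minority r') (maxMinority R')) (minority-flip r r' d')

majorities-flip : ∀ {ℓ} n (R R' : Vec (BitString (suc (2 * n))) ℓ) →
                  hamming (concat R) (concat R') ≡ 1 →
                  SameOrSaturated n (map majority R) (map majority R') (maxMinority R) (maxMinority R')
majorities-flip n []      []        ()
majorities-flip n (r ∷ R) (r' ∷ R') d with hamming-++≡1 r r' (concat R) (concat R') d
... | inj₁ (refl , d') =
  Sum.map (cong (majority r ∷_)) (Product.map (m≤n⇒m≤o⊔n _) (m≤n⇒m≤o⊔n _))
          (majorities-flip n R R' d')
... | inj₂ (d' , e) rewrite concat-injective R R' e =
  Sum.map (cong (_∷ map majority R')) (Product.map (m≤n⇒m≤n⊔o _) (m≤n⇒m≤n⊔o _))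
          (majority-flip n r r' d')

hamming-mask : ∀ n x y → hamming (mask n x) (mask n y) ≤ ∣ x - y ∣
hamming-mask zero    x       y       = z≤n
hamming-mask (suc n) zero    zero    = hamming-mask n zero zero
hamming-mask (suc n) zero    (suc y) = s≤s (hamming-mask n zero y)
hamming-mask (suc n) (suc x) zero    =
  s≤s (≤-trans (hamming-mask n x zero) (≤-reflexive (∣-∣-identityʳ x)))
hamming-mask (suc n) (suc x) (suc y) = hamming-mask n x y

mask-saturated : ∀ n x → n ≤ x → mask n x ≡ replicate n false
mask-saturated zero    x       _         = refl
mask-saturated (suc n) (suc x) (s≤s n≤x) = cong (false ∷_) (mask-saturated n x n≤x)

hamming-∧-mask : ∀ n {s s' : BitString n} {x x'} → ∣ x - x' ∣ ≤ 1 → SameOrSaturated n s s' x x' →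
                 hamming (zipWith _∧_ s (mask n x)) (zipWith _∧_ s' (mask n x')) ≤ 1
hamming-∧-mask n {s} {x = x} {x'} d (inj₁ refl) =
  ≤-trans (hamming-∧ʳ s (mask n x) (mask n x')) (≤-trans (hamming-mask n x x') d)
hamming-∧-mask n {s} {s'} {x} {x'} _ (inj₂ (n≤x , n≤x'))
  rewrite mask-saturated n x n≤x | mask-saturated n x' n≤x' = ≤-trans (≤-reflexive both-zero) z≤n
  where
  both-zero : hamming (zipWith _∧_ s (replicate n false)) (zipWith _∧_ s' (replicate n false)) ≡ 0
  both-zero = trans (cong₂ hamming (zipWith-zeroʳ ∧-zeroʳ s) (zipWith-zeroʳ ∧-zeroʳ s'))
                    (hamming-refl (replicate n false))

data Blocks {ℓ m n} : BitString (ℓ * m + n) → Set where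
  blocks : (R : Vec (BitString m) ℓ) (X : BitString n) → Blocks (concat R ++ X)

toBlocks : ∀ ℓ m {n} (u : BitString (ℓ * m + n)) → Blocks {ℓ} {m} {n} u
toBlocks ℓ m u with splitAt (ℓ * m) u
... | ys , X , refl with group ℓ m ys
...   | R , refl = blocks R X

blobLike⇒oneLipschitz : ∀ ℓ n (f : BitString (ℓ * suc (2 * n) + n) → BitString n) →
                        BlobLike {ℓ} {suc (2 * n)} {n} f →
                        (∀ T → OneLipschitz (slice {ℓ} {suc (2 * n)} {n} f T)) →
                        OneLipschitz f
blobLike⇒oneLipschitz ℓ n f blob lip u v d
  with toBlocks ℓ (suc (2 * n)) u | toBlocks ℓ (suc (2 * n)) v
... | blocks R X | blocks R' X' rewrite blob R X | blob R' X'
  with hamming-++≡1 (concat R) (concat R') X X' d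
... | inj₁ (e , dX) rewrite concat-injective R R' e =
  ≤-trans (hamming-∧ˡ (f′ (map majority R') X) (f′ (map majority R') X') (mask n (maxMinority R')))
          (lip (map majority R') X X' dX)
  where f′ = slice {ℓ} {suc (2 * n)} {n} f
... | inj₂ (dR , refl) =
  hamming-∧-mask n (maxMinority-flip R R' dR)
                   (Sum.map₁ (cong (λ T → slice {ℓ} {suc (2 * n)} {n} f T X)) (majorities-flip n R R' dR))

lemma23 : (ℓ : ℕ) →
    let n = 2 ^ ℓ
        m = suc (2 * n)
    in (f : BitString (ℓ * m + n) → BitString n) →
       BlobLike {ℓ} {m} {n} f →
       (∀ (T : BitString ℓ) → OneLipschitz (slice {ℓ} {m} {n} f T)) →
       OneLipschitz f
lemma23 ℓ = blobLike⇒oneLipschitz ℓ (2 ^ ℓ)
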